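{- Let $S$ be a nonempty finite set and $\mathcal{F}$ a nonempty family of subsets of $S$. Then $$\sum_{(A,B)\in\mathcal{F}^2}|A\otimes B|\ \ge\ \sum_{(A,B)\in\mathcal{F}^2}|A\oplus B|,$$ and the inequality is strict unless every $x\in S$ belongs to exactly half of the members of $\mathcal{F}$.
   Context: $A\oplus B=(A\setminus B)\cup(B\setminus A)$ is the symmetric difference, and $A\otimes B=S\setminus(A\oplus B)=(A\cap B)\cup(A^C\cap B^C)$ is its complement in $S$ (complements $A^C$ taken in $S$). $\mathcal{F}^2$ is the set of ordered pairs of members of $\mathcal{F}$. -}

module Defs where

open import Data.Nat using (ℕ)
open import Data.List using (List; map; length; filter)
open import Data.Nat.ListAction using (sum)
open import Data.Fin using (Fin)
open import Data.Fin.Subset using (Subset; _─_; _∪_; ∁; ∣_∣)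
open import Data.Fin.Subset.Properties using (_∈?_)

_⊕_ : ∀ {n} → Subset n → Subset n → Subset n
A ⊕ B = (A ─ B) ∪ (B ─ A)

_⊗_ : ∀ {n} → Subset n → Subset n → Subset n
A ⊗ B = ∁ (A ⊕ B)

sumPairs : ∀ {n} → (Subset n → Subset n → ℕ) → List (Subset n) → ℕ
sumPairs f F = sum (map (λ A → sum (map (λ B → f A B) F)) F)

degree : ∀ {n} → Fin n → List (Subset n) → ℕ
degree x F = length (filter (λ A → x ∈? A) F)

module Submission where

-- Write F = A₁, …, Aₘ and read each coordinate x of S as a
-- column of m booleans ("x ∈ Aᵢ?") with t ones and f zeros, t + f = m.
-- Both pair sums split coordinatewise: coordinate x contributes 2tf ordered
-- pairs (A, B) that disagree at x, i.e. to Σ |A ⊕ B|, and t² + f² pairs that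
-- agree at x, i.e. to Σ |A ⊗ B|.  Since t² + f² = 2tf + (t - f)², we get
--     Σ |A ⊗ B| = Σ |A ⊕ B| + Σₓ (t_x - f_x)²,
-- which gives the inequality, and equality forces t_x = f_x for every x,
-- i.e. every point lies in exactly half of the members of F.

open import Defs
open import Data.Nat using (ℕ; zero; suc; _+_; _*_; _≤_; ∣_-_∣)
open import Data.Nat.Properties
  using (+-suc; +-assoc; +-identityʳ; *-zeroʳ; m≤m+n; ≤-trans; ≤-reflexive; +-cancelˡ-≡;
         m+n≡0⇒m≡0; m+n≡0⇒n≡0; m*n≡0⇒m≡0∨n≡0; ∣m-n∣≡0⇒m≡n)
open import Data.Nat.ListAction using (sum)
open import Data.Nat.Solver using (module +-*-Solver)
open import Data.Bool using (Bool; true; false; if_then_else_)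
open import Data.List using (List; []; _∷_; length; map)
open import Data.List.Properties using (map-cong; map-∘; length-map)
open import Data.List.Relation.Unary.Unique.Propositional using (Unique)
open import Data.Vec using (head; tail) renaming (_∷_ to _∷ᵛ_; [] to []ᵛ)
open import Data.Fin using (Fin) renaming (zero to fzero; suc to fsuc)
open import Data.Fin.Subset using (Subset; ∣_∣)
open import Data.Fin.Subset.Properties using (_∈?_)
open import Data.Product using (_×_; _,_)
open import Data.Sum using (inj₁; inj₂)
open import Relation.Nullary using (does)
open import Relation.Binary.PropositionalEquality
  using (_≡_; _≢_; refl; sym; trans; cong; cong₂; module ≡-Reasoning)

open +-*-Solver using (solve; _:=_; _:+_; _:*_; con)

sum-map-cong : {X : Set} {f g : X → ℕ} → (∀ a → f a ≡ g a) →
               ∀ xs → sum (map f xs) ≡ sum (map g xs)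
sum-map-cong f≗g xs = cong sum (map-cong f≗g xs)

sum-map-+ : {X : Set} (f g : X → ℕ) →
            ∀ xs → sum (map (λ a → f a + g a) xs) ≡ sum (map f xs) + sum (map g xs)
sum-map-+ f g []       = refl
sum-map-+ f g (x ∷ xs) = begin
  (f x + g x) + sum (map (λ a → f a + g a) xs)
    ≡⟨ cong ((f x + g x) +_) (sum-map-+ f g xs) ⟩
  (f x + g x) + (sum (map f xs) + sum (map g xs))
    ≡⟨ solve 4 (λ a b c d → (a :+ b) :+ (c :+ d) := (a :+ c) :+ (b :+ d))
             refl (f x) (g x) (sum (map f xs)) (sum (map g xs)) ⟩
  (f x + sum (map f xs)) + (g x + sum (map g xs)) ∎
  where open ≡-Reasoning

sum-map-∘ : {X Y : Set} (h : X → Y) (f : Y → ℕ) →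
            ∀ xs → sum (map f (map h xs)) ≡ sum (map (λ a → f (h a)) xs)
sum-map-∘ h f xs = cong sum (sym (map-∘ xs))

pairSum : {X : Set} → (X → X → ℕ) → List X → ℕ
pairSum f xs = sum (map (λ a → sum (map (f a) xs)) xs)

pairSum-cong : {X : Set} {f g : X → X → ℕ} → (∀ a b → f a b ≡ g a b) →
               ∀ xs → pairSum f xs ≡ pairSum g xs
pairSum-cong f≗g xs = sum-map-cong (λ a → sum-map-cong (f≗g a) xs) xs

pairSum-+ : {X : Set} (f g : X → X → ℕ) →
            ∀ xs → pairSum (λ a b → f a b + g a b) xs ≡ pairSum f xs + pairSum g xs
pairSum-+ f g xs =
  trans (sum-map-cong (λ a → sum-map-+ (f a) (g a) xs) xs)
        (sum-map-+ (λ a → sum (map (f a) xs)) (λ a → sum (map (g a) xs)) xs)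

pairSum-map : {X Y : Set} (h : X → Y) (f : Y → Y → ℕ) →
              ∀ xs → pairSum f (map h xs) ≡ pairSum (λ a b → f (h a) (h b)) xs
pairSum-map h f xs =
  trans (sum-map-∘ h (λ a → sum (map (f a) (map h xs))) xs)
        (sum-map-cong (λ a → sum-map-∘ h (f (h a)) xs) xs)

pairSum-zero : {X : Set} {f : X → X → ℕ} → (∀ a b → f a b ≡ 0) →
               ∀ xs → pairSum f xs ≡ 0
pairSum-zero f≡0 xs =
  trans (sum-map-cong (λ a → trans (sum-map-cong (f≡0 a) xs) (sum-zeros xs)) xs)
        (sum-zeros xs)
  where
  sum-zeros : {X : Set} (ys : List X) → sum (map (λ _ → 0) ys) ≡ 0
  sum-zeros []       = refl
  sum-zeros (_ ∷ ys) = sum-zeros ys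


trues falses : List Bool → ℕ
trues []           = 0
trues (true ∷ bs)  = suc (trues bs)
trues (false ∷ bs) = trues bs
falses []           = 0
falses (true ∷ bs)  = falses bs
falses (false ∷ bs) = suc (falses bs)

trues+falses : ∀ bs → trues bs + falses bs ≡ length bs
trues+falses []           = refl
trues+falses (true ∷ bs)  = cong suc (trues+falses bs)
trues+falses (false ∷ bs) = trans (+-suc (trues bs) (falses bs)) (cong suc (trues+falses bs))

differ agree : Bool → Bool → ℕ
differ true  true  = 0
differ true  false = 1
differ false true  = 1
differ false false = 0
agree true  true  = 1
agree true  false = 0
agree false true  = 0
agree false false = 1

differ-row : ∀ a bs → sum (map (differ a) bs) ≡ (if a then falses bs else trues bs)
differ-row true  []           = refl
differ-row false []           = refl
differ-row true  (true ∷ bs)  = differ-row true bs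
differ-row true  (false ∷ bs) = cong suc (differ-row true bs)
differ-row false (true ∷ bs)  = cong suc (differ-row false bs)
differ-row false (false ∷ bs) = differ-row false bs

agree-row : ∀ a bs → sum (map (agree a) bs) ≡ (if a then trues bs else falses bs)
agree-row true  []           = refl
agree-row false []           = refl
agree-row true  (true ∷ bs)  = cong suc (agree-row true bs)
agree-row true  (false ∷ bs) = agree-row true bs
agree-row false (true ∷ bs)  = agree-row false bs
agree-row false (false ∷ bs) = cong suc (agree-row false bs)

sum-select : ∀ u v bs → sum (map (λ b → if b then u else v) bs) ≡ trues bs * u + falses bs * v
sum-select u v []           = refl
sum-select u v (true ∷ bs)  =
  trans (cong (u +_) (sum-select u v bs)) (sym (+-assoc u (trues bs * u) (falses bs * v)))
sum-select u v (false ∷ bs) =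
  trans (cong (v +_) (sum-select u v bs))
        (solve 3 (λ v x y → v :+ (x :+ y) := x :+ (v :+ y)) refl v (trues bs * u) (falses bs * v))

pairSum-differ : ∀ bs → pairSum differ bs ≡ trues bs * falses bs + falses bs * trues bs
pairSum-differ bs =
  trans (sum-map-cong (λ a → differ-row a bs) bs) (sum-select (falses bs) (trues bs) bs)

pairSum-agree : ∀ bs → pairSum agree bs ≡ trues bs * trues bs + falses bs * falses bs
pairSum-agree bs =
  trans (sum-map-cong (λ a → agree-row a bs) bs) (sum-select (trues bs) (falses bs) bs)


square : ℕ → ℕ
square k = k * k

squares-split : ∀ d e → d * d + e * e ≡ (d * e + e * d) + square ∣ d - e ∣
squares-split zero    e       = cong (_+ e * e) (sym (*-zeroʳ e))
squares-split (suc d) zero    =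
  solve 1 (λ d → (con 1 :+ d) :* (con 1 :+ d) :+ con 0
               := ((con 1 :+ d) :* con 0 :+ con 0) :+ (con 1 :+ d) :* (con 1 :+ d)) refl d
squares-split (suc d) (suc e) = begin
  suc d * suc d + suc e * suc e
    ≡⟨ solve 2 (λ d e → (con 1 :+ d) :* (con 1 :+ d) :+ (con 1 :+ e) :* (con 1 :+ e)
                     := (d :* d :+ e :* e) :+ (con 2 :+ con 2 :* d :+ con 2 :* e)) refl d e ⟩
  (d * d + e * e) + (2 + 2 * d + 2 * e)
    ≡⟨ cong (_+ (2 + 2 * d + 2 * e)) (squares-split d e) ⟩
  ((d * e + e * d) + k) + (2 + 2 * d + 2 * e)
    ≡⟨ solve 3 (λ d e k → ((d :* e :+ e :* d) :+ k) :+ (con 2 :+ con 2 :* d :+ con 2 :* e)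
                       := ((con 1 :+ d) :* (con 1 :+ e) :+ (con 1 :+ e) :* (con 1 :+ d)) :+ k)
             refl d e k ⟩
  (suc d * suc e + suc e * suc d) + k ∎
  where
  open ≡-Reasoning
  k = square ∣ d - e ∣

column-excess : ∀ bs → pairSum agree bs ≡ pairSum differ bs + square ∣ trues bs - falses bs ∣
column-excess bs = begin
  pairSum agree bs
    ≡⟨ pairSum-agree bs ⟩
  trues bs * trues bs + falses bs * falses bs
    ≡⟨ squares-split (trues bs) (falses bs) ⟩
  (trues bs * falses bs + falses bs * trues bs) + square ∣ trues bs - falses bs ∣
    ≡⟨ cong (_+ square ∣ trues bs - falses bs ∣) (sym (pairSum-differ bs)) ⟩
  pairSum differ bs + square ∣ trues bs - falses bs ∣ ∎
  where open ≡-Reasoning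


firstColumn : ∀ {n} → List (Subset (suc n)) → List Bool
firstColumn = map head

restrict : ∀ {n} → List (Subset (suc n)) → List (Subset n)
restrict = map tail

pairSum-split : ∀ {n} (f : Subset (suc n) → Subset (suc n) → ℕ)
                (g : Bool → Bool → ℕ) (h : Subset n → Subset n → ℕ) →
                (∀ a b A B → f (a ∷ᵛ A) (b ∷ᵛ B) ≡ g a b + h A B) →
                ∀ F → pairSum f F ≡ pairSum g (firstColumn F) + pairSum h (restrict F)
pairSum-split f g h f-split F = begin
  pairSum f F
    ≡⟨ pairSum-cong (λ { (a ∷ᵛ A) (b ∷ᵛ B) → f-split a b A B }) F ⟩
  pairSum (λ A B → g (head A) (head B) + h (tail A) (tail B)) F
    ≡⟨ pairSum-+ (λ A B → g (head A) (head B)) (λ A B → h (tail A) (tail B)) F ⟩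
  pairSum (λ A B → g (head A) (head B)) F + pairSum (λ A B → h (tail A) (tail B)) F
    ≡⟨ sym (cong₂ _+_ (pairSum-map head g F) (pairSum-map tail h F)) ⟩
  pairSum g (firstColumn F) + pairSum h (restrict F) ∎
  where open ≡-Reasoning

⊕-cons : ∀ {n} a b (A B : Subset n) → ∣ (a ∷ᵛ A) ⊕ (b ∷ᵛ B) ∣ ≡ differ a b + ∣ A ⊕ B ∣
⊕-cons true  true  A B = refl
⊕-cons true  false A B = refl
⊕-cons false true  A B = refl
⊕-cons false false A B = refl

⊗-cons : ∀ {n} a b (A B : Subset n) → ∣ (a ∷ᵛ A) ⊗ (b ∷ᵛ B) ∣ ≡ agree a b + ∣ A ⊗ B ∣
⊗-cons true  true  A B = refl
⊗-cons true  false A B = refl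
⊗-cons false true  A B = refl
⊗-cons false false A B = refl

Σ⊕ Σ⊗ : ∀ {n} → List (Subset n) → ℕ
Σ⊕ F = sumPairs (λ A B → ∣ A ⊕ B ∣) F
Σ⊗ F = sumPairs (λ A B → ∣ A ⊗ B ∣) F

imbalance : ∀ n → List (Subset n) → ℕ
imbalance zero    F = 0
imbalance (suc n) F = square ∣ trues (firstColumn F) - falses (firstColumn F) ∣
                    + imbalance n (restrict F)

Σ⊗≡Σ⊕+imbalance : ∀ n (F : List (Subset n)) → Σ⊗ F ≡ Σ⊕ F + imbalance n F
Σ⊗≡Σ⊕+imbalance zero    F =
  trans (pairSum-zero (λ { []ᵛ []ᵛ → refl }) F)
        (sym (trans (+-identityʳ (Σ⊕ F)) (pairSum-zero (λ { []ᵛ []ᵛ → refl }) F)))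
Σ⊗≡Σ⊕+imbalance (suc n) F = begin
  Σ⊗ F
    ≡⟨ pairSum-split _ agree _ ⊗-cons F ⟩
  pairSum agree c + Σ⊗ R
    ≡⟨ cong₂ _+_ (column-excess c) (Σ⊗≡Σ⊕+imbalance n R) ⟩
  (pairSum differ c + k) + (Σ⊕ R + imbalance n R)
    ≡⟨ solve 4 (λ x k p d → (x :+ k) :+ (p :+ d) := (x :+ p) :+ (k :+ d))
             refl (pairSum differ c) k (Σ⊕ R) (imbalance n R) ⟩
  (pairSum differ c + Σ⊕ R) + imbalance (suc n) F
    ≡⟨ cong (_+ imbalance (suc n) F) (sym (pairSum-split _ differ _ ⊕-cons F)) ⟩
  Σ⊕ F + imbalance (suc n) F ∎
  where
  open ≡-Reasoning
  c = firstColumn F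
  R = restrict F
  k = square ∣ trues c - falses c ∣


degree-first : ∀ {n} (F : List (Subset (suc n))) → degree fzero F ≡ trues (firstColumn F)
degree-first []                 = refl
degree-first ((true ∷ᵛ A) ∷ F)  = cong suc (degree-first F)
degree-first ((false ∷ᵛ A) ∷ F) = degree-first F

degree-rest : ∀ {n} (x : Fin n) (F : List (Subset (suc n))) →
              degree (fsuc x) F ≡ degree x (restrict F)
degree-rest x []             = refl
degree-rest x ((a ∷ᵛ A) ∷ F) with does (x ∈? A)
... | true  = cong suc (degree-rest x F)
... | false = degree-rest x F

balanced-column : ∀ bs → trues bs ≡ falses bs → 2 * trues bs ≡ length bs
balanced-column bs t≡f = begin
  trues bs + (trues bs + 0)  ≡⟨ cong (trues bs +_) (+-identityʳ (trues bs)) ⟩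
  trues bs + trues bs        ≡⟨ cong (trues bs +_) t≡f ⟩
  trues bs + falses bs       ≡⟨ trues+falses bs ⟩
  length bs ∎
  where open ≡-Reasoning

square-zero : ∀ m → square m ≡ 0 → m ≡ 0
square-zero m m²≡0 with m*n≡0⇒m≡0∨n≡0 m m²≡0
... | inj₁ m≡0 = m≡0
... | inj₂ m≡0 = m≡0

imbalance-zero⇒balanced : ∀ n (F : List (Subset n)) → imbalance n F ≡ 0 →
                          (x : Fin n) → 2 * degree x F ≡ length F
imbalance-zero⇒balanced (suc n) F zero-imbalance fzero = begin
  2 * degree fzero F   ≡⟨ cong (2 *_) (degree-first F) ⟩
  2 * trues c          ≡⟨ balanced-column c (∣m-n∣≡0⇒m≡n (square-zero _ first-zero)) ⟩
  length c             ≡⟨ length-map head F ⟩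
  length F ∎
  where
  open ≡-Reasoning
  c = firstColumn F
  first-zero = m+n≡0⇒m≡0 (square ∣ trues c - falses c ∣) zero-imbalance
imbalance-zero⇒balanced (suc n) F zero-imbalance (fsuc x) = begin
  2 * degree (fsuc x) F       ≡⟨ cong (2 *_) (degree-rest x F) ⟩
  2 * degree x (restrict F)   ≡⟨ imbalance-zero⇒balanced n (restrict F) rest-zero x ⟩
  length (restrict F)         ≡⟨ length-map tail F ⟩
  length F ∎
  where
  open ≡-Reasoning
  c = firstColumn F
  rest-zero = m+n≡0⇒n≡0 (square ∣ trues c - falses c ∣) zero-imbalance


proposition4 : (n : ℕ) → (F : List (Subset (suc n))) → Unique F → F ≢ [] →
    (sumPairs (λ A B → ∣ A ⊕ B ∣) F ≤ sumPairs (λ A B → ∣ A ⊗ B ∣) F)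
    × (sumPairs (λ A B → ∣ A ⊕ B ∣) F ≡ sumPairs (λ A B → ∣ A ⊗ B ∣) F →
       (x : Fin (suc n)) → 2 * degree x F ≡ length F)
proposition4 n F _ _ = inequality , equality-case
  where
  identity : Σ⊗ F ≡ Σ⊕ F + imbalance (suc n) F
  identity = Σ⊗≡Σ⊕+imbalance (suc n) F

  inequality : Σ⊕ F ≤ Σ⊗ F
  inequality = ≤-trans (m≤m+n (Σ⊕ F) (imbalance (suc n) F)) (≤-reflexive (sym identity))

  equality-case : Σ⊕ F ≡ Σ⊗ F → (x : Fin (suc n)) → 2 * degree x F ≡ length F
  equality-case Σ⊕≡Σ⊗ = imbalance-zero⇒balanced (suc n) F
    (+-cancelˡ-≡ (Σ⊕ F) (imbalance (suc n) F) 0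
      (trans (sym (trans Σ⊕≡Σ⊗ identity)) (sym (+-identityʳ (Σ⊕ F)))))
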